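{- Let $\Omega$ be a set with $|\Omega|=5$ and let $\mathcal{H}$ be a minimal domination completion of $\mathcal{U}_{3,\Omega}$. If there exists $A\in\mathcal{H}$ with $|A|=3$, then $\mathcal{H}=\mathcal{D}(G)$ for some graph $G$ with vertex set $\Omega$ isomorphic to $K_{2,3}$.
   Context: Graphs are finite, simple, undirected; $\mathcal{D}(G)$ is the family of inclusion-minimal dominating sets of $G$ (a dominating set is $D\subseteq V(G)$ such that every vertex outside $D$ has a neighbour in $D$). A hypergraph on $\Omega$ is a nonempty family of nonempty subsets of $\Omega$, none a proper subset of another; it has ground set $\Omega$ if the union of its members is $\Omega$. A domination hypergraph is one of the form $\mathcal{D}(G)$. $\mathcal{U}_{3,\Omega}=\{A\subseteq\Omega:|A|=3\}$. $\mathcal{H}_1\leqslant\mathcal{H}_2$ means: for every $A_1\in\mathcal{H}_1$ there is $A_2\in\mathcal{H}_2$ with $A_2\subseteq A_1$. A domination completion of $\mathcal{U}_{3,\Omega}$ is a domination hypergraph $\mathcal{H}$ with ground set $\Omega$ and $\mathcal{U}_{3,\Omega}\leqslant\mathcal{H}$; it is minimal if it is $\leqslant$-minimal among all domination completions. -}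

module Defs where

open import Data.Nat using (ℕ; _<_; _<ᵇ_)
open import Data.Bool using (Bool; true; false; _xor_)
open import Data.Fin using (Fin; toℕ)
open import Data.Fin.Subset using (Subset; _∈_; _∉_; _⊆_; ∣_∣)
open import Data.Fin.Permutation using (Permutation′; _⟨$⟩ʳ_)
open import Data.Product using (Σ; ∃; ∃-syntax; _×_)
open import Relation.Binary.PropositionalEquality using (_≡_; _≢_)
open import Relation.Nullary using (¬_)
open import Level using (Level; suc; zero)

record Graph (n : ℕ) : Set where
  field
    adj   : Fin n → Fin n → Bool
    sym   : ∀ u v → adj u v ≡ adj v u
    irrefl : ∀ v → adj v v ≡ false
open Graph public

Dominating : ∀ {n} → Graph n → Subset n → Set
Dominating G D = ∀ v → v ∉ D → ∃[ u ] (u ∈ D × adj G u v ≡ true)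

MinDom : ∀ {n} → Graph n → Subset n → Set
MinDom G D = Dominating G D × (∀ B → B ⊆ D → Dominating G B → D ⊆ B)

Family : ℕ → Set₁
Family n = Subset n → Set

_≐_ : ∀ {n} → Family n → Family n → Set
H₁ ≐ H₂ = ∀ A → (H₁ A → H₂ A) × (H₂ A → H₁ A)

IsHypergraph : ∀ {n} → Family n → Set
IsHypergraph {n} H =
  (∃[ A ] H A)
  × (∀ A → H A → ∃[ x ] x ∈ A)
  × (∀ A B → H A → H B → A ⊆ B → A ≡ B)

HasGroundSetAll : ∀ {n} → Family n → Set
HasGroundSetAll {n} H = ∀ (x : Fin n) → ∃[ A ] (H A × x ∈ A)

_≼_ : ∀ {n} → Family n → Family n → Set
H₁ ≼ H₂ = ∀ A₁ → H₁ A₁ → ∃[ A₂ ] (H₂ A₂ × A₂ ⊆ A₁)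

𝒟 : ∀ {n} → Graph n → Family n
𝒟 G = MinDom G

IsDominationHypergraph : ∀ {n} → Family n → Set
IsDominationHypergraph {n} H = ∃[ G ] (H ≐ 𝒟 {n} G)

𝒰₃ : ∀ {n} → Family n
𝒰₃ A = ∣ A ∣ ≡ 3

IsDominationCompletion : ∀ {n} → Family n → Set
IsDominationCompletion H =
  IsHypergraph H × HasGroundSetAll H × IsDominationHypergraph H × (𝒰₃ ≼ H)

IsMinimalDominationCompletion : ∀ {n} → Family n → Set₁
IsMinimalDominationCompletion {n} H =
  IsDominationCompletion H
  × (∀ (H' : Family n) → IsDominationCompletion H' → H' ≼ H → H' ≐ H)

-- K_{2,3} on Fin 5: parts {0,1} and {2,3,4}
K₂₃ : Graph 5
K₂₃ = record { adj = λ i j → (toℕ i <ᵇ 2) xor (toℕ j <ᵇ 2)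
             ; sym = λ { i j → xor-comm (toℕ i <ᵇ 2) (toℕ j <ᵇ 2) }
             ; irrefl = λ v → xor-self (toℕ v <ᵇ 2) }
  where
  xor-comm : ∀ a b → (a xor b) ≡ (b xor a)
  xor-comm false false = Relation.Binary.PropositionalEquality.refl
  xor-comm false true = Relation.Binary.PropositionalEquality.refl
  xor-comm true false = Relation.Binary.PropositionalEquality.refl
  xor-comm true true = Relation.Binary.PropositionalEquality.refl
  xor-self : ∀ a → (a xor a) ≡ false
  xor-self false = Relation.Binary.PropositionalEquality.refl
  xor-self true = Relation.Binary.PropositionalEquality.refl

_≅_ : ∀ {n} → Graph n → Graph n → Set
G ≅ G' = Σ (Permutation′ _) λ π → ∀ u v → adj G' (π ⟨$⟩ʳ u) (π ⟨$⟩ʳ v) ≡ adj G u v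

-- Write H = 𝒟(G₀) and let A ∈ H have three elements. Since 𝒰₃ ≤ H, every
-- 3-set dominates G₀; together with the minimality of A as a dominating set,
-- this forces every minimal dominating set of the complete bipartite graph K
-- with parts A and Ω ∖ A (these are A, Ω ∖ A and the pairs meeting both parts)
-- to dominate G₀, a fact checked exhaustively over all graphs on five vertices.
-- Hence 𝒟(K) ≤ H, and as 𝒟(K) is itself a domination completion, minimality
-- of H gives H = 𝒟(K), where K ≅ K₂,₃.
module Submission where

open import Defs
open import Data.Fin.Subset using (∣_∣)
open import Data.Product using (∃-syntax; _×_)
open import Relation.Binary.PropositionalEquality using (_≡_)

open import Data.Bool using (Bool; true; false; _xor_)
open import Data.Bool.Properties using (xor-comm; xor-same) renaming (_≟_ to _≟ᵇ_)
open import Data.Empty using (⊥-elim)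
open import Data.Fin using (Fin; zero; suc)
open import Data.Fin.Patterns using (0F; 1F)
open import Data.Fin.Permutation using (Permutation′; _⟨$⟩ʳ_; _∘ₚ_; transpose)
open import Data.Fin.Properties using (all?; any?)
open import Data.Fin.Subset using (Subset; _∈_; _∉_; _⊆_; _⊂_; _-_; ⊤; inside; outside)
open import Data.Fin.Subset.Induction using (⊂-wellFounded)
open import Data.Fin.Subset.Properties
  using (_∈?_; anySubset?; ∈⊤; ⊆-antisym; ⊂-irref; ⊂-⊆-trans; x∈p⇒p-x⊂p; x∈p∧x≢y⇒x∈p-y; p─q⊆p)
open import Data.Nat using (ℕ; zero; suc) renaming (_≟_ to _≟ℕ_)
open import Data.Product using (_,_; proj₁; proj₂; ∃₂)
open import Data.Unit using (tt) renaming (⊤ to Unit)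
open import Data.Vec using (_∷_; []; lookup; tabulate)
open import Data.Vec.Properties using (lookup∘tabulate)
open import Function using (_∘_; id)
open import Induction.WellFounded using (Acc; acc)
open import Relation.Binary.PropositionalEquality as ≡ using (refl; trans)
open import Relation.Nullary using (¬_; Dec; yes; no)
open import Relation.Nullary.Decidable using (map′; from-yes; ¬?; _×-dec_; _→-dec_)
open import Relation.Unary using (Pred; Decidable)

private
  variable
    n : ℕ

allSubset? : ∀ {p} {P : Pred (Subset n) p} → Decidable P → Dec (∀ A → P A)
allSubset? {zero} P? = map′ (λ { p [] → p }) (λ ∀P → ∀P []) (P? [])
allSubset? {suc n} P? =
  map′ (λ { (ins , out) (inside ∷ A) → ins A ; (ins , out) (outside ∷ A) → out A })
       (λ ∀P → (λ A → ∀P (inside ∷ A)) , (λ A → ∀P (outside ∷ A)))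
       (allSubset? (P? ∘ (inside ∷_)) ×-dec allSubset? (P? ∘ (outside ∷_)))

p⊆q∧x∉p⇒p⊆q-x : ∀ {B D : Subset n} {x} → B ⊆ D → x ∉ B → B ⊆ D - x
p⊆q∧x∉p⇒p⊆q-x B⊆D x∉B {y} y∈B = x∈p∧x≢y⇒x∈p-y (B⊆D y∈B) λ { refl → x∉B y∈B }

module _ (G : Graph n) where

  dominating? : Decidable (Dominating G)
  dominating? D =
    all? λ v → ¬? (v ∈? D) →-dec any? λ u → (u ∈? D) ×-dec (adj G u v ≟ᵇ true)

  dominating-mono : ∀ {B C} → B ⊆ C → Dominating G B → Dominating G C
  dominating-mono B⊆C dB v v∉C =
    let u , u∈B , uv = dB v (v∉C ∘ B⊆C) in u , B⊆C u∈B , uv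

  minDom⇒irredundant : ∀ {D x} → MinDom G D → x ∈ D → ¬ Dominating G (D - x)
  minDom⇒irredundant (_ , minimal) x∈D d-x =
    ⊂-irref refl (⊂-⊆-trans (x∈p⇒p-x⊂p x∈D) (minimal _ (p─q⊆p _ _) d-x))

  irredundant⇒minDom : ∀ {D} → Dominating G D →
                       (∀ x → x ∈ D → ¬ Dominating G (D - x)) → MinDom G D
  irredundant⇒minDom {D} dD irr = dD , minimal
    where
    minimal : ∀ B → B ⊆ D → Dominating G B → D ⊆ B
    minimal B B⊆D dB {x} x∈D with x ∈? B
    ... | yes x∈B = x∈B
    ... | no x∉B = ⊥-elim (irr x x∈D (dominating-mono (p⊆q∧x∉p⇒p⊆q-x B⊆D x∉B) dB))

  minDom? : Decidable (MinDom G)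
  minDom? D =
    map′ (λ (dD , irr) → irredundant⇒minDom dD irr)
         (λ m → proj₁ m , λ x → minDom⇒irredundant m)
         (dominating? D ×-dec all? λ x → (x ∈? D) →-dec ¬? (dominating? (D - x)))

  dominating⇒minDom⊆ : ∀ {D} → Dominating G D → ∃[ B ] (MinDom G B × B ⊆ D)
  dominating⇒minDom⊆ {D} = go (⊂-wellFounded D)
    where
    go : ∀ {D} → Acc _⊂_ D → Dominating G D → ∃[ B ] (MinDom G B × B ⊆ D)
    go {D} (acc smaller) dD with any? (λ x → (x ∈? D) ×-dec dominating? (D - x))
    ... | yes (x , x∈D , d-x) =
      let B , mB , B⊆D-x = go (smaller (x∈p⇒p-x⊂p x∈D)) d-x in B , mB , p─q⊆p D _ ∘ B⊆D-x
    ... | no ¬red = D , irredundant⇒minDom dD (λ x x∈D d-x → ¬red (x , x∈D , d-x)) , id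

𝒟-isHypergraph : (G : Graph (suc n)) → IsHypergraph (𝒟 G)
𝒟-isHypergraph G = nonempty , members-nonempty , antichain
  where
  nonempty : ∃[ A ] 𝒟 G A
  nonempty = let B , mB , _ = dominating⇒minDom⊆ G (λ v v∉⊤ → ⊥-elim (v∉⊤ ∈⊤)) in B , mB

  members-nonempty : ∀ A → 𝒟 G A → ∃[ x ] x ∈ A
  members-nonempty A (dA , _) with zero ∈? A
  ... | yes 0∈A = zero , 0∈A
  ... | no 0∉A = let u , u∈A , _ = dA zero 0∉A in u , u∈A

  antichain : ∀ A B → 𝒟 G A → 𝒟 G B → A ⊆ B → A ≡ B
  antichain A B (dA , _) (_ , minB) A⊆B = ⊆-antisym A⊆B (minB A A⊆B dA)

≐-sym : {H₁ H₂ : Family n} → H₁ ≐ H₂ → H₂ ≐ H₁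
≐-sym H₁≐H₂ A = proj₂ (H₁≐H₂ A) , proj₁ (H₁≐H₂ A)

≼-respʳ-≐ : {H₁ H₂ H₃ : Family n} → H₂ ≐ H₃ → H₁ ≼ H₂ → H₁ ≼ H₃
≼-respʳ-≐ H₂≐H₃ H₁≼H₂ A HA = let B , H₂B , B⊆A = H₁≼H₂ A HA in B , proj₁ (H₂≐H₃ B) H₂B , B⊆A

dominating⇒≼𝒟 : {F : Family n} (G : Graph n) → (∀ A → F A → Dominating G A) → F ≼ 𝒟 G
dominating⇒≼𝒟 G dom A FA = dominating⇒minDom⊆ G (dom A FA)

≼𝒟⇒dominating : {F : Family n} (G : Graph n) → F ≼ 𝒟 G → ∀ A → F A → Dominating G A
≼𝒟⇒dominating G F≼𝒟G A FA = let B , (dB , _) , B⊆A = F≼𝒟G A FA in dominating-mono G B⊆A dB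

record _≈_ (G G′ : Graph n) : Set where
  constructor mk≈
  field adj-≡ : ∀ u v → adj G u v ≡ adj G′ u v
open _≈_

≈-sym : {G G′ : Graph n} → G ≈ G′ → G′ ≈ G
≈-sym G≈G′ = mk≈ λ u v → ≡.sym (adj-≡ G≈G′ u v)

dominating-resp-≈ : {G G′ : Graph n} → G ≈ G′ → ∀ {D} → Dominating G D → Dominating G′ D
dominating-resp-≈ G≈G′ dD v v∉D =
  let u , u∈D , uv = dD v v∉D in u , u∈D , trans (≡.sym (adj-≡ G≈G′ u v)) uv

minDom-resp-≈ : {G G′ : Graph n} → G ≈ G′ → ∀ {D} → MinDom G D → MinDom G′ D
minDom-resp-≈ G≈G′ (dD , minimal) =
  dominating-resp-≈ G≈G′ dD , λ B B⊆D dB → minimal B B⊆D (dominating-resp-≈ (≈-sym G≈G′) dB)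

-- A code for a graph on Fin (suc n) lists the neighbours of 0 among the other
-- vertices, followed by a code for the graph induced on the others.
GraphCode : ℕ → Set
GraphCode zero = Unit
GraphCode (suc n) = Subset n × GraphCode n

codeAdj : GraphCode n → Fin n → Fin n → Bool
codeAdj {suc n} (N , c) zero    zero    = false
codeAdj {suc n} (N , c) zero    (suc v) = lookup N v
codeAdj {suc n} (N , c) (suc u) zero    = lookup N u
codeAdj {suc n} (N , c) (suc u) (suc v) = codeAdj c u v

codeAdj-sym : ∀ (c : GraphCode n) u v → codeAdj c u v ≡ codeAdj c v u
codeAdj-sym {suc n} c zero    zero    = refl
codeAdj-sym {suc n} c zero    (suc v) = refl
codeAdj-sym {suc n} c (suc u) zero    = refl
codeAdj-sym {suc n} c (suc u) (suc v) = codeAdj-sym (proj₂ c) u v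

codeAdj-irrefl : ∀ (c : GraphCode n) v → codeAdj c v v ≡ false
codeAdj-irrefl {suc n} c zero    = refl
codeAdj-irrefl {suc n} c (suc v) = codeAdj-irrefl (proj₂ c) v

fromCode : GraphCode n → Graph n
fromCode c = record { adj = codeAdj c ; sym = codeAdj-sym c ; irrefl = codeAdj-irrefl c }

induced-suc : Graph (suc n) → Graph n
induced-suc G = record
  { adj = λ u v → adj G (suc u) (suc v)
  ; sym = λ u v → sym G (suc u) (suc v)
  ; irrefl = irrefl G ∘ suc
  }

code : Graph n → GraphCode n
code {zero} G = tt
code {suc n} G = tabulate (adj G zero ∘ suc) , code (induced-suc G)

codeAdj-code : (G : Graph n) → ∀ u v → codeAdj (code G) u v ≡ adj G u v
codeAdj-code {suc n} G zero    zero    = ≡.sym (irrefl G zero)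
codeAdj-code {suc n} G zero    (suc v) = lookup∘tabulate (adj G zero ∘ suc) v
codeAdj-code {suc n} G (suc u) zero    =
  trans (lookup∘tabulate (adj G zero ∘ suc) u) (sym G zero (suc u))
codeAdj-code {suc n} G (suc u) (suc v) = codeAdj-code (induced-suc G) u v

allCode? : ∀ {p} {P : Pred (GraphCode n) p} → Decidable P → Dec (∀ c → P c)
allCode? {zero} P? = map′ (λ p _ → p) (λ ∀P → ∀P tt) (P? tt)
allCode? {suc n} P? =
  map′ (λ ∀P (N , c) → ∀P N c) (λ ∀P N c → ∀P (N , c))
       (allSubset? λ N → allCode? λ c → P? (N , c))

∀-code⇒∀-graph : ∀ {p} (P : Graph n → Set p) → (∀ {G G′} → G ≈ G′ → P G → P G′) →
                 (∀ c → P (fromCode c)) → ∀ G → P G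
∀-code⇒∀-graph P resp ∀P G = resp (mk≈ (codeAdj-code G)) (∀P (code G))

completeBipartite : Subset n → Graph n
completeBipartite A = record
  { adj = λ u v → lookup A u xor lookup A v
  ; sym = λ u v → xor-comm (lookup A u) (lookup A v)
  ; irrefl = λ v → xor-same (lookup A v)
  }

ThreeSetsDominate : Graph 5 → Set
ThreeSetsDominate G = (S : Subset 5) → 𝒰₃ S → Dominating G S

threeSetsDominate? : (G : Graph 5) → Dec (ThreeSetsDominate G)
threeSetsDominate? G = allSubset? λ S → (∣ S ∣ ≟ℕ 3) →-dec dominating? G S

bipartite-groundSet : (A : Subset 5) → 𝒰₃ A → HasGroundSetAll (𝒟 (completeBipartite A))
bipartite-groundSet = from-yes (allSubset? {n = 5} λ A → (∣ A ∣ ≟ℕ 3) →-dec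
  all? λ x → anySubset? λ B → minDom? (completeBipartite A) B ×-dec (x ∈? B))

bipartite-threeSetsDominate : (A : Subset 5) → 𝒰₃ A → ThreeSetsDominate (completeBipartite A)
bipartite-threeSetsDominate = from-yes (allSubset? {n = 5} λ A → (∣ A ∣ ≟ℕ 3) →-dec
  threeSetsDominate? (completeBipartite A))

IsIsomorphism : (G G′ : Graph n) → Permutation′ n → Set
IsIsomorphism G G′ π = ∀ u v → adj G′ (π ⟨$⟩ʳ u) (π ⟨$⟩ʳ v) ≡ adj G u v

-- Two transpositions move the two vertices outside A onto {0, 1}.
bipartite-isomorphism : (A : Subset 5) → 𝒰₃ A → ∃₂ λ i j →
  IsIsomorphism (completeBipartite A) K₂₃ (transpose 0F i ∘ₚ transpose 1F j)
bipartite-isomorphism = from-yes (allSubset? {n = 5} λ A → (∣ A ∣ ≟ℕ 3) →-dec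
  any? λ i → any? λ j → all? λ u → all? λ v →
    let π = transpose 0F i ∘ₚ transpose 1F j
    in adj K₂₃ (π ⟨$⟩ʳ u) (π ⟨$⟩ʳ v) ≟ᵇ adj (completeBipartite A) u v)

bipartite≅K₂₃ : (A : Subset 5) → 𝒰₃ A → completeBipartite A ≅ K₂₃
bipartite≅K₂₃ A |A|≡3 =
  let i , j , iso = bipartite-isomorphism A |A|≡3 in transpose 0F i ∘ₚ transpose 1F j , iso

BipartiteDominates : Graph 5 → Set
BipartiteDominates G = ThreeSetsDominate G → ∀ A → 𝒰₃ A → MinDom G A →
                       ∀ B → MinDom (completeBipartite A) B → Dominating G B

bipartiteDominates : ∀ G → BipartiteDominates G
bipartiteDominates = ∀-code⇒∀-graph BipartiteDominates resp
  (from-yes (allCode? {n = 5} λ c → let G = fromCode c in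
    threeSetsDominate? G →-dec allSubset? λ A → (∣ A ∣ ≟ℕ 3) →-dec
      (minDom? G A →-dec allSubset? λ B → minDom? (completeBipartite A) B →-dec dominating? G B)))
  where
  resp : ∀ {G G′} → G ≈ G′ → BipartiteDominates G → BipartiteDominates G′
  resp G≈G′ core three A |A|≡3 mA B mB =
    dominating-resp-≈ G≈G′
      (core (λ S |S|≡3 → dominating-resp-≈ (≈-sym G≈G′) (three S |S|≡3))
            A |A|≡3 (minDom-resp-≈ (≈-sym G≈G′) mA) B mB)

bipartite-completion : (A : Subset 5) → 𝒰₃ A → IsDominationCompletion (𝒟 (completeBipartite A))
bipartite-completion A |A|≡3 =
  𝒟-isHypergraph K , bipartite-groundSet A |A|≡3 , (K , λ _ → id , id) ,
  dominating⇒≼𝒟 K (bipartite-threeSetsDominate A |A|≡3)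
  where K = completeBipartite A

lemma4p17 : (H : Family 5) → IsMinimalDominationCompletion H
    → (∃[ A ] (H A × ∣ A ∣ ≡ 3))
    → ∃[ G ] ((H ≐ 𝒟 G) × (G ≅ K₂₃))
lemma4p17 H ((_ , _ , (G₀ , H≐𝒟G₀) , 𝒰₃≼H) , minimal) (A , HA , |A|≡3) =
  K , ≐-sym (minimal (𝒟 K) (bipartite-completion A |A|≡3) 𝒟K≼H) , bipartite≅K₂₃ A |A|≡3
  where
  K = completeBipartite A

  threeSets : ThreeSetsDominate G₀
  threeSets = ≼𝒟⇒dominating G₀ (≼-respʳ-≐ H≐𝒟G₀ 𝒰₃≼H)

  𝒟K≼H : 𝒟 K ≼ H
  𝒟K≼H = ≼-respʳ-≐ (≐-sym H≐𝒟G₀) (dominating⇒≼𝒟 G₀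
    (bipartiteDominates G₀ threeSets A |A|≡3 (proj₁ (H≐𝒟G₀ A) HA)))
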